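{- If a multiplier $-\ltimes U:\mathcal W\to\mathcal V$ is cancellative and affine, then it is providently affine: for every presheaf $\Psi$ on $\mathcal W$, the functor $\mathrm{Fr}^\Psi_U:\int_{\mathcal W}\Psi\to\int_{\mathcal V}(\Psi\ltimes\mathbf yU)$ is full.
   Context: $\mathcal W$ has a terminal object $\top$. A multiplier for $U\in\mathcal V$ is a functor $-\ltimes U:\mathcal W\to\mathcal V$ with an isomorphism $\top\ltimes U\cong U$; $\pi_2:W\ltimes U\to U$ is $(!_W\ltimes U)$ followed by it. $\mathrm{Fr}_U:\mathcal W\to\mathcal V/U$, $W\mapsto(W\ltimes U,\pi_2)$, $f\mapsto f\ltimes U$; cancellative / affine means $\mathrm{Fr}_U$ faithful / full. $\int_{\mathcal C}\Gamma$ is the category of elements of a presheaf $\Gamma$. For a presheaf $\Psi$ on $\mathcal W$, $\Psi\ltimes\mathbf yU$ is the presheaf on $\mathcal V$ with $(\Psi\ltimes\mathbf yU)(V)=\int^{W}\mathcal V(V,W\ltimes U)\times\Psi(W)$; $\psi\ltimes\mathbf yU$ denotes the class of $(\mathrm{id}_{W\ltimes U},\psi)$. $\mathrm{Fr}^\Psi_U(W,\psi)=(W\ltimes U,\psi\ltimes\mathbf yU)$ and $\mathrm{Fr}^\Psi_U(f)=f\ltimes U$. -}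

module Defs where

open import Level using (Level; _⊔_; Setω) renaming (suc to lsuc)
open import Data.Product using (Σ; Σ-syntax; _×_; _,_)
open import Relation.Binary.PropositionalEquality using (_≡_)
open import Relation.Binary.Construct.Closure.Equivalence using (EqClosure)

record Category (o ℓ : Level) : Set (lsuc (o ⊔ ℓ)) where
  infixr 9 _∘_
  field
    Obj       : Set o
    Hom       : Obj → Obj → Set ℓ
    id        : ∀ {A} → Hom A A
    _∘_       : ∀ {A B C} → Hom B C → Hom A B → Hom A C
    identityˡ : ∀ {A B} (f : Hom A B) → id ∘ f ≡ f
    identityʳ : ∀ {A B} (f : Hom A B) → f ∘ id ≡ f
    assoc     : ∀ {A B C D} (f : Hom A B) (g : Hom B C) (h : Hom C D) →
                (h ∘ g) ∘ f ≡ h ∘ (g ∘ f)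

record Functor {o₁ ℓ₁ o₂ ℓ₂} (C : Category o₁ ℓ₁) (D : Category o₂ ℓ₂)
       : Set (o₁ ⊔ ℓ₁ ⊔ o₂ ⊔ ℓ₂) where
  private
    module C = Category C
    module D = Category D
  field
    F₀   : C.Obj → D.Obj
    F₁   : ∀ {A B} → C.Hom A B → D.Hom (F₀ A) (F₀ B)
    F-id : ∀ {A} → F₁ (C.id {A}) ≡ D.id
    F-∘  : ∀ {A B C} (f : C.Hom A B) (g : C.Hom B C) →
           F₁ (g C.∘ f) ≡ F₁ g D.∘ F₁ f

record Presheaf {o ℓ} (C : Category o ℓ) (p : Level) : Set (o ⊔ ℓ ⊔ lsuc p) where
  private module C = Category C
  field
    F₀   : C.Obj → Set p
    F₁   : ∀ {A B} → C.Hom A B → F₀ B → F₀ A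
    F-id : ∀ {A} (x : F₀ A) → F₁ C.id x ≡ x
    F-∘  : ∀ {A B C} (f : C.Hom A B) (g : C.Hom B C) (x : F₀ C) →
           F₁ (g C.∘ f) x ≡ F₁ f (F₁ g x)

record Terminal {o ℓ} (C : Category o ℓ) : Set (o ⊔ ℓ) where
  open Category C
  field
    ⊤        : Obj
    !        : (A : Obj) → Hom A ⊤
    !-unique : ∀ {A} (f : Hom A ⊤) → f ≡ ! A

record Multiplier {o₁ ℓ₁ o₂ ℓ₂} (W : Category o₁ ℓ₁) (V : Category o₂ ℓ₂)
       (T : Terminal W) (U : Category.Obj V) : Set (o₁ ⊔ ℓ₁ ⊔ o₂ ⊔ ℓ₂) where
  private
    module W = Category W
    module V = Category V
    module T = Terminal T
  field
    ⋉U     : Functor W V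
  open Functor ⋉U public renaming (F₀ to _⋉₀; F₁ to _⋉₁)
  field
    unit    : V.Hom (T.⊤ ⋉₀) U
    unit⁻¹  : V.Hom U (T.⊤ ⋉₀)
    unit-isoˡ : unit V.∘ unit⁻¹ ≡ V.id
    unit-isoʳ : unit⁻¹ V.∘ unit ≡ V.id

  π₂ : (A : W.Obj) → V.Hom (A ⋉₀) U
  π₂ A = unit V.∘ (T.! A ⋉₁)

module _ {o₁ ℓ₁ o₂ ℓ₂} {W : Category o₁ ℓ₁} {V : Category o₂ ℓ₂}
         {T : Terminal W} {U : Category.Obj V} (M : Multiplier W V T U) where
  private
    module W = Category W
    module V = Category V
  open Multiplier M

  -- Fr_U : W → V/U is faithful
  Cancellative : Set (o₁ ⊔ ℓ₁ ⊔ ℓ₂)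
  Cancellative = ∀ {A B} (f g : W.Hom A B) → f ⋉₁ ≡ g ⋉₁ → f ≡ g

  -- Fr_U : W → V/U is full: every morphism (A⋉U,π₂) → (B⋉U,π₂) of V/U
  -- is of the form f⋉U
  Affine : Set (o₁ ⊔ ℓ₁ ⊔ ℓ₂)
  Affine = ∀ {A B} (g : V.Hom (A ⋉₀) (B ⋉₀)) → π₂ B V.∘ g ≡ π₂ A →
           Σ[ f ∈ W.Hom A B ] f ⋉₁ ≡ g

  module _ {p : Level} (Ψ : Presheaf W p) where
    private module Ψ = Presheaf Ψ

    -- Representatives of elements of (Ψ ⋉ yU)(X) = ∫^A V(X, A⋉U) × Ψ(A)
    CoendRep : V.Obj → Set (o₁ ⊔ ℓ₂ ⊔ p)
    CoendRep X = Σ[ A ∈ W.Obj ] (V.Hom X (A ⋉₀) × Ψ.F₀ A)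

    data CoendStep (X : V.Obj) : CoendRep X → CoendRep X → Set (o₁ ⊔ ℓ₁ ⊔ ℓ₂ ⊔ p) where
      step : ∀ {A B} (k : W.Hom A B) (h : V.Hom X (A ⋉₀)) (ψ : Ψ.F₀ B) →
             CoendStep X (B , (k ⋉₁) V.∘ h , ψ) (A , h , Ψ.F₁ k ψ)

    CoendEq : (X : V.Obj) → CoendRep X → CoendRep X → Set (o₁ ⊔ ℓ₁ ⊔ ℓ₂ ⊔ p)
    CoendEq X = EqClosure (CoendStep X)

    act : ∀ {X Y} → V.Hom X Y → CoendRep Y → CoendRep X
    act g (A , h , ψ) = (A , h V.∘ g , ψ)

    _⋉y : ∀ {A} → Ψ.F₀ A → CoendRep (A ⋉₀)
    _⋉y {A} ψ = (A , V.id , ψ)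

    -- Fr^Ψ_U : ∫Ψ → ∫(Ψ ⋉ yU) is full: any morphism
    -- g : (A⋉U, ψ⋉yU) → (B⋉U, ψ'⋉yU) of ∫(Ψ⋉yU), i.e. g with
    -- (Ψ⋉yU)(g)(ψ'⋉yU) = ψ⋉yU, is f⋉U for some morphism
    -- f : (A,ψ) → (B,ψ') of ∫Ψ, i.e. with Ψ(f)(ψ') = ψ.
    FrFull : Set (o₁ ⊔ ℓ₁ ⊔ ℓ₂ ⊔ p)
    FrFull = ∀ {A B} (ψ : Ψ.F₀ A) (ψ' : Ψ.F₀ B) (g : V.Hom (A ⋉₀) (B ⋉₀)) →
             CoendEq (A ⋉₀) (act g (ψ' ⋉y)) (ψ ⋉y) →
             Σ[ f ∈ W.Hom A B ] ((Ψ.F₁ f ψ' ≡ ψ) × (f ⋉₁ ≡ g))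

  ProvidentlyAffine : Setω
  ProvidentlyAffine = (p : Level) (Ψ : Presheaf W p) → FrFull Ψ

-- Call a representative (C , h , χ) of (Ψ ⋉ yU)(A ⋉ U) lifted over ψ₀ ∈ Ψ(A)
-- when h = k ⋉ U for some k : A → C of W with Ψ(k)(χ) = ψ₀. The
-- representative (A , id , ψ₀) of ψ₀ ⋉ yU is lifted over ψ₀, and being lifted
-- over ψ₀ is invariant under the generating relation of the coend: backwards
-- by functoriality, forwards because a map h with (k ⋉ U) ∘ h = j ⋉ U lies over
-- U, hence is h' ⋉ U by affineness, and then j = k ∘ h' by cancellativity.
-- So if g^*(ψ' ⋉ yU) = ψ ⋉ yU, the representative (B , g , ψ') is lifted over
-- ψ, which is exactly a morphism (A , ψ) → (B , ψ') of ∫Ψ mapped to g.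
module Submission where

open import Defs
open import Level using (Level; _⊔_)
open import Data.Product using (Σ-syntax; _×_; _,_)
open import Relation.Binary.PropositionalEquality
open import Relation.Binary.Construct.Closure.Symmetric using (fwd; bwd)
open import Relation.Binary.Construct.Closure.ReflexiveTransitive using (ε; _◅_)

module _ {o₁ ℓ₁ o₂ ℓ₂ : Level} {W : Category o₁ ℓ₁} {V : Category o₂ ℓ₂}
         {T : Terminal W} {U : Category.Obj V} (M : Multiplier W V T U) where
  private
    module W = Category W
    module V = Category V
    module T = Terminal T
  open Multiplier M
  open ≡-Reasoning

  π₂-natural : ∀ {A C} (j : W.Hom A C) → π₂ C V.∘ (j ⋉₁) ≡ π₂ A
  π₂-natural {A} {C} j = begin
    (unit V.∘ (T.! C ⋉₁)) V.∘ (j ⋉₁)  ≡⟨ V.assoc (j ⋉₁) (T.! C ⋉₁) unit ⟩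
    unit V.∘ ((T.! C ⋉₁) V.∘ (j ⋉₁))  ≡⟨ cong (unit V.∘_) (sym (F-∘ j (T.! C))) ⟩
    unit V.∘ ((T.! C W.∘ j) ⋉₁)       ≡⟨ cong (λ z → unit V.∘ (z ⋉₁)) (T.!-unique _) ⟩
    unit V.∘ (T.! A ⋉₁)               ∎

  lies-over-U : ∀ {A B C} (k : W.Hom B C) (h : V.Hom (A ⋉₀) (B ⋉₀)) (j : W.Hom A C) →
                j ⋉₁ ≡ (k ⋉₁) V.∘ h → π₂ B V.∘ h ≡ π₂ A
  lies-over-U {A} {B} {C} k h j j⋉≡k⋉∘h = begin
    π₂ B V.∘ h               ≡⟨ cong (V._∘ h) (sym (π₂-natural k)) ⟩
    (π₂ C V.∘ (k ⋉₁)) V.∘ h  ≡⟨ V.assoc h (k ⋉₁) (π₂ C) ⟩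
    π₂ C V.∘ ((k ⋉₁) V.∘ h)  ≡⟨ cong (π₂ C V.∘_) (sym j⋉≡k⋉∘h) ⟩
    π₂ C V.∘ (j ⋉₁)          ≡⟨ π₂-natural j ⟩
    π₂ A                     ∎

  factor-⋉ : Cancellative M → Affine M →
             ∀ {A B C} (k : W.Hom B C) (h : V.Hom (A ⋉₀) (B ⋉₀)) (j : W.Hom A C) →
             j ⋉₁ ≡ (k ⋉₁) V.∘ h →
             Σ[ h' ∈ W.Hom A B ] ((h' ⋉₁ ≡ h) × (j ≡ k W.∘ h'))
  factor-⋉ canc aff k h j j⋉≡k⋉∘h with aff h (lies-over-U k h j j⋉≡k⋉∘h)
  ... | h' , h'⋉≡h = h' , h'⋉≡h , canc j (k W.∘ h') (begin
    j ⋉₁                ≡⟨ j⋉≡k⋉∘h ⟩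
    (k ⋉₁) V.∘ h        ≡⟨ cong ((k ⋉₁) V.∘_) (sym h'⋉≡h) ⟩
    (k ⋉₁) V.∘ (h' ⋉₁)  ≡⟨ sym (F-∘ h' k) ⟩
    (k W.∘ h') ⋉₁       ∎)

  module _ {p : Level} (Ψ : Presheaf W p) {A : W.Obj} where
    private module Ψ = Presheaf Ψ

    LiftedOver : CoendRep M Ψ (A ⋉₀) → Ψ.F₀ A → Set (ℓ₁ ⊔ ℓ₂ ⊔ p)
    LiftedOver (C , h , χ) ψ₀ = Σ[ k ∈ W.Hom A C ] ((k ⋉₁ ≡ h) × (Ψ.F₁ k χ ≡ ψ₀))

    lifted-id : ∀ ψ₀ → LiftedOver (_⋉y M Ψ ψ₀) ψ₀
    lifted-id ψ₀ = W.id , F-id , Ψ.F-id ψ₀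

    lifted-step⁻¹ : ∀ {r s} → CoendStep M Ψ (A ⋉₀) r s → ∀ {ψ₀} → LiftedOver s ψ₀ → LiftedOver r ψ₀
    lifted-step⁻¹ (step k h ψ) (j , j⋉≡h , Ψj≡ψ₀) =
      k W.∘ j , trans (F-∘ j k) (cong ((k ⋉₁) V.∘_) j⋉≡h) , trans (Ψ.F-∘ j k ψ) Ψj≡ψ₀

    module _ (canc : Cancellative M) (aff : Affine M) where

      lifted-step : ∀ {r s} → CoendStep M Ψ (A ⋉₀) r s → ∀ {ψ₀} → LiftedOver r ψ₀ → LiftedOver s ψ₀
      lifted-step (step k h ψ) {ψ₀} (j , j⋉≡k⋉∘h , Ψj≡ψ₀)
        with factor-⋉ canc aff k h j j⋉≡k⋉∘h
      ... | h' , h'⋉≡h , j≡k∘h' = h' , h'⋉≡h , (begin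
        Ψ.F₁ h' (Ψ.F₁ k ψ)  ≡⟨ sym (Ψ.F-∘ h' k ψ) ⟩
        Ψ.F₁ (k W.∘ h') ψ   ≡⟨ cong (λ z → Ψ.F₁ z ψ) (sym j≡k∘h') ⟩
        Ψ.F₁ j ψ            ≡⟨ Ψj≡ψ₀ ⟩
        ψ₀                  ∎)

      lifted-resp⁻¹ : ∀ {r s} → CoendEq M Ψ (A ⋉₀) r s → ∀ {ψ₀} → LiftedOver s ψ₀ → LiftedOver r ψ₀
      lifted-resp⁻¹ ε              lifted = lifted
      lifted-resp⁻¹ (fwd st ◅ r~s) lifted = lifted-step⁻¹ st (lifted-resp⁻¹ r~s lifted)
      lifted-resp⁻¹ (bwd st ◅ r~s) lifted = lifted-step st (lifted-resp⁻¹ r~s lifted)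

mainTheorem14 : ∀ {o₁ ℓ₁ o₂ ℓ₂ : Level} {W : Category o₁ ℓ₁} {V : Category o₂ ℓ₂}
                  {T : Terminal W} {U : Category.Obj V} (M : Multiplier W V T U) →
                  Cancellative M → Affine M → ProvidentlyAffine M
mainTheorem14 {V = V} M canc aff p Ψ ψ ψ' g g*ψ'≡ψ
  with lifted-resp⁻¹ M Ψ canc aff g*ψ'≡ψ (lifted-id M Ψ ψ)
... | f , f⋉≡g∘id , Ψf≡ψ = f , Ψf≡ψ , trans f⋉≡g∘id (Category.identityˡ V g)
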